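{- The maps $f$ (from finite words on positive integers to $E$) and $g$ (from $E$ to finite words on positive integers) are inverses of each other.
   Context: The standardization $\mathrm{Std}(w)$ of a word $w=w_1\dots w_n$ on positive integers is the permutation of $[n]$ obtained by scanning $w$ from left to right and replacing occurrences of the smallest letter by $1,2,\dots,k$, then occurrences of the second smallest by $k+1,\dots$, and so on. $E$ is the set of infinite sequences $a=(a_1,a_2,\dots)$ of nonnegative integers with finitely many nonzero entries such that the subword $a_{j_1}\dots a_{j_k}$ ($j_1<\dots<j_k$) of nonzero entries (the associated permutation) is a permutation of $[k]$. $f$: for $w=w_1\dots w_n$ with $\tau=\mathrm{Std}(w)^{ -1}=\tau_1\dots\tau_n$, $f(w)$ is the sequence consisting of $w_{\tau_1}-1$ zeros, then $\tau_1$, then for each $i=1,\dots,n-1$: $w_{\tau_{i+1}}-w_{\tau_i}$ zeros if $\tau_i<\tau_{i+1}$, or $w_{\tau_{i+1}}-w_{\tau_i}-1$ zeros if $\tau_i>\tau_{i+1}$, followed by $\tau_{i+1}$; then infinitely many zeros. $g$: for $a\in E$ with associated permutation $a_{j_1}\dots a_{j_k}$, $g(a)=w_1\dots w_k$ where $w_{a_{j_1}}=j_1$ and, for $i=1,\dots,k-1$, $w_{a_{j_{i+1}}}=w_{a_{j_i}}+(j_{i+1}-j_i)-1$ if $a_{j_i}<a_{j_{i+1}}$ and $w_{a_{j_{i+1}}}=w_{a_{j_i}}+(j_{i+1}-j_i)$ otherwise. -}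

module Defs where

open import Data.Nat using (ℕ; zero; suc; _+_; _∸_; _≤_; _<ᵇ_; _≡ᵇ_)
open import Data.Bool using (Bool; true; false; if_then_else_)
open import Data.List using (List; []; _∷_; _++_; map; length; replicate; upTo; filter; foldr)
open import Data.Product using (_×_; _,_; Σ)
open import Relation.Binary.PropositionalEquality using (_≡_)
open import Data.List.Relation.Binary.Permutation.Propositional using (_↭_)

-- Conventions
--  * A word w = w₁…wₙ is a  List ℕ ; it is a word on POSITIVE integers
--    when  All (1 ≤_) w  (stated in the theorem).
--  * Positions in words and sequences are 1-based in the paper.
--  * An infinite sequence a = (a₁,a₂,…) is a function  a : ℕ → ℕ  with
--    a i  standing for  a_{i+1}  (0-based index into the sequence).

Seq : Set
Seq = ℕ → ℕ

oneTo : ℕ → List ℕ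
oneTo n = map suc (upTo n)

-- 1-based lookup in a list, default 0
at : List ℕ → ℕ → ℕ
at []       _             = 0
at (x ∷ xs) zero          = 0
at (x ∷ xs) (suc zero)    = x
at (x ∷ xs) (suc (suc i)) = at xs (suc i)

-- 0-based lookup in a list, default 0 (used to view a finite list as
-- an infinite sequence padded with zeros)
at₀ : List ℕ → ℕ → ℕ
at₀ []       _       = 0
at₀ (x ∷ xs) zero    = x
at₀ (x ∷ xs) (suc i) = at₀ xs i

count : (ℕ → Bool) → List ℕ → ℕ
count p = foldr (λ x r → if p x then suc r else r) 0

-- Scanning left to right and numbering the occurrences
-- of the smallest letter 1,2,…,k, then those of the next letter, etc.,
-- the letter at position i receives the number
--   1 + #{ j : w_j < w_i } + #{ j < i : w_j = w_i }.
std : List ℕ → List ℕ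
std w = map (λ i → suc (count (λ j → at w j <ᵇ at w i) (oneTo n)
                         + count (λ j → (j <ᵇ i) Data.Bool.∧ (at w j ≡ᵇ at w i)) (oneTo n)))
            (oneTo n)
  where n = length w

-- 1-based position of the first occurrence of k in a list (0 if absent)
indexOf : ℕ → List ℕ → ℕ
indexOf k []       = 0
indexOf k (x ∷ xs) = if x ≡ᵇ k then 1 else (if indexOf k xs ≡ᵇ 0 then 0 else suc (indexOf k xs))

-- inverse of a permutation of [n] given in one-line notation
invPerm : List ℕ → List ℕ
invPerm σ = map (λ k → indexOf k σ) (oneTo (length σ))

tau : List ℕ → List ℕ
tau w = invPerm (std w)

fSteps : List ℕ → ℕ → List ℕ → List ℕ
fSteps w t []        = []
fSteps w t (t' ∷ ts) =
  replicate (if t' <ᵇ t then at w t' ∸ at w t ∸ 1 else at w t' ∸ at w t) 0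
  ++ t' ∷ fSteps w t' ts

fList : List ℕ → List ℕ
fList w with tau w
... | []     = []
... | t ∷ ts = replicate (at w t ∸ 1) 0 ++ t ∷ fSteps w t ts

f : List ℕ → Seq
f w = at₀ (fList w)

-- a vanishes from (0-based) index N on, i.e. a_i = 0 for all i > N
BoundedBy : ℕ → Seq → Set
BoundedBy N a = ∀ i → N ≤ i → a i ≡ 0

-- nonzero entries among the first N: pairs (j , a_j), j 1-based, j increasing
nonzeros : ℕ → Seq → List (ℕ × ℕ)
nonzeros zero    a = []
nonzeros (suc N) a = if a 0 ≡ᵇ 0 then rest else (1 , a 0) ∷ rest
  where rest = map (λ { (j , v) → (suc j , v) }) (nonzeros N (λ i → a (suc i)))

assocPerm : ℕ → Seq → List ℕ
assocPerm N a = map Data.Product.proj₂ (nonzeros N a)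

IsPermutation : List ℕ → Set
IsPermutation l = l ↭ oneTo (length l)

InE : Seq → Set
InE a = Σ ℕ (λ N → BoundedBy N a × IsPermutation (assocPerm N a))

-- input: pairs (j_i , a_{j_i}); output: pairs (a_{j_i} , w_{a_{j_i}})
gGo : ℕ → ℕ → ℕ → List (ℕ × ℕ) → List (ℕ × ℕ)
gGo j p v []               = []
gGo j p v ((j' , p') ∷ ps) = (p' , v') ∷ gGo j' p' v' ps
  where v' = if p <ᵇ p' then v + (j' ∸ j) ∸ 1 else v + (j' ∸ j)

gVals : List (ℕ × ℕ) → List (ℕ × ℕ)
gVals []             = []
gVals ((j , p) ∷ ps) = (p , j) ∷ gGo j p j ps

assoc : ℕ → List (ℕ × ℕ) → ℕ
assoc k []             = 0
assoc k ((p , v) ∷ ps) = if p ≡ᵇ k then v else assoc k ps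

g : ℕ → Seq → List ℕ
g N a = map (λ p → assoc p (gVals ps)) (oneTo (length ps))
  where ps = nonzeros N a

-- Both maps factor through run-length encoding: a finitely supported
-- sequence is a list of blocks (z , x), z zeros followed by a nonzero
-- entry x.  For a word w, τ = Std(w)⁻¹ lists the positions of w in
-- increasing order of (w_t , t), since Std(w)_t − 1 counts the positions
-- preceding t in that order.  The blocks of f(w) carry the entries
-- τ₁, τ₂, … and their runs record the increments of w along τ, one less
-- at each descent of τ; g reads the values w_{τᵢ} back from the runs.
-- Runs and values determine each other step by step as long as
-- consecutive entries differ.  Conversely, the associated permutation of
-- a ∈ E is the sorted order of positions of the word g(a), so f re-encodes
-- exactly the blocks of a.

module Submission where

open import Defs
open import Data.Nat using (ℕ; zero; suc; _+_; _∸_; _≤_; _<_; z≤n; s≤s; _<ᵇ_; _≡ᵇ_)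
open import Data.Nat.Properties
open import Data.Bool using (Bool; true; false; if_then_else_; _∧_; _∨_; T)
open import Data.Bool.Properties using (∧-zeroʳ)
open import Data.List using (List; []; _∷_; _++_; map; length; replicate; upTo)
open import Data.List.Properties using (map-∘; map-id; map-cong; map-cong-local; map-upTo; length-map; length-upTo)
open import Data.List.Relation.Unary.All as All using (All; []; _∷_)
open import Data.List.Relation.Unary.All.Properties as All using ()
open import Data.List.Relation.Unary.Any using (here; there)
open import Data.List.Relation.Unary.AllPairs using (AllPairs; _∷_)
open import Data.List.Relation.Unary.Linked as Linked using (Linked; []; [-]; _∷_)
open import Data.List.Relation.Unary.Linked.Properties using (Linked⇒AllPairs; AllPairs⇒Linked; map⁺; map⁻)
open import Data.List.Relation.Unary.Unique.Propositional using (Unique)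
import Data.List.Relation.Unary.Unique.Propositional.Properties as Unique
open import Data.List.Membership.Propositional using (_∈_)
open import Data.List.Membership.Propositional.Properties using (∈-map⁺; ∈-map⁻; ∈-∃++; ∈-++⁺ʳ; ∈-upTo⁺; ∈-upTo⁻)
open import Data.List.Relation.Binary.Permutation.Propositional as ↭ using (_↭_; ↭-sym; ↭⇒↭ₛ)
open import Data.List.Relation.Binary.Permutation.Propositional.Properties using (∈-resp-↭; ↭-length)
import Data.List.Relation.Binary.Permutation.Setoid.Properties as ↭ₛ
open import Data.Product using (Σ; _×_; _,_; proj₁; proj₂; uncurry)
open import Data.Sum using (_⊎_; inj₁; inj₂)
open import Data.Empty using (⊥-elim)
open import Relation.Nullary using (¬_; yes; no)
open import Relation.Binary.Definitions using (tri<; tri≈; tri>)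
open import Relation.Nullary.Decidable using (dec-true; dec-false)
open import Relation.Binary.PropositionalEquality
open import Function using (_∘_)
open import Level using (0ℓ)
open import Relation.Binary.Bundles using (StrictTotalOrder; DecTotalOrder)
import Relation.Binary.Construct.On as On
open import Data.Product.Relation.Binary.Lex.Strict using (×-strictTotalOrder)

<⇒<ᵇ≡true : ∀ {m n} → m < n → (m <ᵇ n) ≡ true
<⇒<ᵇ≡true {m} {n} = dec-true (m <? n)

≮⇒<ᵇ≡false : ∀ {m n} → ¬ m < n → (m <ᵇ n) ≡ false
≮⇒<ᵇ≡false {m} {n} = dec-false (m <? n)

≡⇒≡ᵇ≡true : ∀ {m n} → m ≡ n → (m ≡ᵇ n) ≡ true
≡⇒≡ᵇ≡true {m} {n} = dec-true (m ≟ n)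

≢⇒≡ᵇ≡false : ∀ {m n} → m ≢ n → (m ≡ᵇ n) ≡ false
≢⇒≡ᵇ≡false {m} {n} = dec-false (m ≟ n)

oneTo-suc : ∀ n → oneTo (suc n) ≡ 1 ∷ map suc (oneTo n)
oneTo-suc n = cong (λ l → 1 ∷ map suc l) (sym (map-upTo suc n))

length-oneTo : ∀ n → length (oneTo n) ≡ n
length-oneTo n = trans (length-map suc (upTo n)) (length-upTo n)

∈-oneTo⁺ : ∀ {n k} → 1 ≤ k → k ≤ n → k ∈ oneTo n
∈-oneTo⁺ {k = suc j} _ j<n = ∈-map⁺ suc (∈-upTo⁺ j<n)

∈-oneTo⁻ : ∀ {n k} → k ∈ oneTo n → 1 ≤ k × k ≤ n
∈-oneTo⁻ k∈ with ∈-map⁻ suc k∈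
... | j , j∈ , refl = s≤s z≤n , ∈-upTo⁻ j∈

oneTo-unique : ∀ n → Unique (oneTo n)
oneTo-unique n = Unique.map⁺ suc-injective (Unique.upTo⁺ n)

at-map-oneTo : ∀ (h : ℕ → ℕ) n k → 1 ≤ k → k ≤ n → at (map h (oneTo n)) k ≡ h k
at-map-oneTo h (suc n) (suc zero) _ _ = cong (λ l → at (map h l) 1) (oneTo-suc n)
at-map-oneTo h (suc n) (suc (suc k)) _ (s≤s k≤n) = begin
  at (map h (oneTo (suc n))) (suc (suc k))   ≡⟨ cong (λ l → at (map h l) (suc (suc k))) (oneTo-suc n) ⟩
  at (map h (map suc (oneTo n))) (suc k)     ≡⟨ cong (λ l → at l (suc k)) (sym (map-∘ (oneTo n))) ⟩
  at (map (h ∘ suc) (oneTo n)) (suc k)       ≡⟨ at-map-oneTo (h ∘ suc) n (suc k) (s≤s z≤n) k≤n ⟩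
  h (suc (suc k))                            ∎
  where open ≡-Reasoning

map-at-oneTo : ∀ (p : List ℕ) → map (at p) (oneTo (length p)) ≡ p
map-at-oneTo []       = refl
map-at-oneTo (x ∷ xs) = begin
  map (at (x ∷ xs)) (oneTo (suc n))                 ≡⟨ cong (map (at (x ∷ xs))) (oneTo-suc n) ⟩
  x ∷ map (at (x ∷ xs)) (map suc (map suc (upTo n))) ≡⟨ cong (x ∷_) (sym (map-∘ (map suc (upTo n)))) ⟩
  x ∷ map (at (x ∷ xs) ∘ suc) (map suc (upTo n))     ≡⟨ cong (x ∷_) (sym (map-∘ (upTo n))) ⟩
  x ∷ map (at xs ∘ suc) (upTo n)                     ≡⟨ cong (x ∷_) (map-∘ (upTo n)) ⟩
  x ∷ map (at xs) (oneTo n)                          ≡⟨ cong (x ∷_) (map-at-oneTo xs) ⟩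
  x ∷ xs                                             ∎
  where open ≡-Reasoning
        n = length xs

at-∈ : ∀ (p : List ℕ) k → 1 ≤ k → k ≤ length p → at p k ∈ p
at-∈ (x ∷ p) (suc zero)    _ _         = here refl
at-∈ (x ∷ p) (suc (suc k)) _ (s≤s k≤n) = there (at-∈ p (suc k) (s≤s z≤n) k≤n)

at₀-beyond : ∀ (l : List ℕ) i → length l ≤ i → at₀ l i ≡ 0
at₀-beyond []      i       _         = refl
at₀-beyond (x ∷ l) (suc i) (s≤s l≤i) = at₀-beyond l i l≤i

count-↭ : ∀ (q : ℕ → Bool) {xs ys} → xs ↭ ys → count q xs ≡ count q ys
count-↭ q ↭.refl = refl
count-↭ q (↭.prep x r) rewrite count-↭ q r = refl
count-↭ q (↭.swap x y r) rewrite count-↭ q r with q x | q y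
... | true  | true  = refl
... | true  | false = refl
... | false | true  = refl
... | false | false = refl
count-↭ q (↭.trans r s) = trans (count-↭ q r) (count-↭ q s)

count-∨ : ∀ (q r : ℕ → Bool) (l : List ℕ) → (∀ x → (q x ∧ r x) ≡ false) →
          count q l + count r l ≡ count (λ x → q x ∨ r x) l
count-∨ q r []      _        = refl
count-∨ q r (x ∷ l) disjoint with q x | r x | disjoint x | count-∨ q r l disjoint
... | true  | true  | () | _
... | true  | false | _  | ih = cong suc ih
... | false | true  | _  | ih = trans (+-suc _ _) (cong suc ih)
... | false | false | _  | ih = ih

count-none : ∀ (q : ℕ → Bool) {l} → All (λ x → q x ≡ false) l → count q l ≡ 0
count-none q []           = refl
count-none q (qx ∷ qxs) rewrite qx = count-none q qxs

1≤indexOf : ∀ (p : List ℕ) {x} → x ∈ p → 1 ≤ indexOf x p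
1≤indexOf (y ∷ p) {x} x∈ with y ≡ᵇ x in y≡ᵇx
... | true  = s≤s z≤n
... | false with x∈
...   | here refl = ⊥-elim (subst T y≡ᵇx (≡⇒≡ᵇ x x refl))
...   | there x∈p with indexOf x p | 1≤indexOf p x∈p
...     | zero  | ()
...     | suc i | _ = s≤s z≤n

at-indexOf : ∀ (p : List ℕ) {x} → x ∈ p → at p (indexOf x p) ≡ x
at-indexOf (y ∷ p) {x} x∈ with y ≡ᵇ x in y≡ᵇx
... | true = ≡ᵇ⇒≡ y x (subst T (sym y≡ᵇx) _)
... | false with x∈
...   | here refl = ⊥-elim (subst T y≡ᵇx (≡⇒≡ᵇ x x refl))
...   | there x∈p with indexOf x p | at-indexOf p x∈p | 1≤indexOf p x∈p
...     | zero  | _  | ()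
...     | suc i | eq | _ = eq

indexOf-at : ∀ (p : List ℕ) → Unique p → ∀ k → 1 ≤ k → k ≤ length p → indexOf (at p k) p ≡ k
indexOf-at (x ∷ p) _ (suc zero) _ _ rewrite ≡⇒≡ᵇ≡true {x} refl = refl
indexOf-at (x ∷ p) (x∉ ∷ u) (suc (suc k)) _ (s≤s k≤n)
  rewrite ≢⇒≡ᵇ≡false (All.lookup x∉ (at-∈ p (suc k) (s≤s z≤n) k≤n))
        | indexOf-at p u (suc k) (s≤s z≤n) k≤n = refl

indexOf-first : ∀ (l : List ℕ) k i → 1 ≤ i → i ≤ length l → at l i ≡ k →
                (∀ i′ → 1 ≤ i′ → i′ < i → at l i′ ≢ k) → indexOf k l ≡ i
indexOf-first (x ∷ l) k (suc zero) _ _ x≡k _ rewrite ≡⇒≡ᵇ≡true x≡k = refl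
indexOf-first (x ∷ l) k (suc (suc i)) _ (s≤s i≤n) atl≡k earlier
  rewrite ≢⇒≡ᵇ≡false (earlier 1 (s≤s z≤n) (s≤s (s≤s z≤n)))
        | indexOf-first l k (suc i) (s≤s z≤n) i≤n atl≡k
            (λ { (suc i′) _ (s≤s i′<i) → earlier (suc (suc i′)) (s≤s z≤n) (s≤s (s≤s i′<i)) })
  = refl

-- Permutations of [1..n]

module _ {p : List ℕ} {n : ℕ} (perm : p ↭ oneTo n) where

  ↭oneTo⇒unique : Unique p
  ↭oneTo⇒unique = ↭ₛ.Unique-resp-↭ (setoid ℕ) (↭⇒↭ₛ (↭-sym perm)) (oneTo-unique n)

  length-↭oneTo : length p ≡ n
  length-↭oneTo = trans (↭-length perm) (length-oneTo n)

  ↭oneTo⇒IsPermutation : IsPermutation p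
  ↭oneTo⇒IsPermutation = subst (λ m → p ↭ oneTo m) (sym length-↭oneTo) perm

  ∈-↭oneTo⁻ : ∀ {x} → x ∈ p → 1 ≤ x × x ≤ n
  ∈-↭oneTo⁻ x∈ = ∈-oneTo⁻ (∈-resp-↭ perm x∈)

  ∈-↭oneTo⁺ : ∀ {x} → 1 ≤ x → x ≤ n → x ∈ p
  ∈-↭oneTo⁺ 1≤x x≤n = ∈-resp-↭ (↭-sym perm) (∈-oneTo⁺ 1≤x x≤n)

invPerm-involutive : ∀ {p} → IsPermutation p → invPerm (invPerm p) ≡ p
invPerm-involutive {p} perm = begin
  map (λ k → indexOf k q) (oneTo (length q))
    ≡⟨ cong (λ m → map (λ k → indexOf k q) (oneTo m)) ∣q∣≡n ⟩
  map (λ k → indexOf k q) (oneTo n)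
    ≡⟨ map-cong-local (All.tabulate (uncurry indexOf-q ∘ ∈-oneTo⁻)) ⟩
  map (at p) (oneTo n)
    ≡⟨ map-at-oneTo p ⟩
  p ∎
  where
  open ≡-Reasoning
  n = length p
  q = invPerm p
  ∣q∣≡n : length q ≡ n
  ∣q∣≡n = trans (length-map _ (oneTo n)) (length-oneTo n)
  at-q : ∀ i → 1 ≤ i → i ≤ n → at q i ≡ indexOf i p
  at-q = at-map-oneTo (λ k → indexOf k p) n
  indexOf-q : ∀ {k} → 1 ≤ k → k ≤ n → indexOf k q ≡ at p k
  indexOf-q {k} 1≤k k≤n with 1≤y , y≤n ← ∈-↭oneTo⁻ perm (at-∈ p k 1≤k k≤n) =
    indexOf-first q k y 1≤y (subst (y ≤_) (sym ∣q∣≡n) y≤n)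
      (trans (at-q y 1≤y y≤n) (indexOf-at p (↭oneTo⇒unique perm) k 1≤k k≤n)) earlier
    where
    y = at p k
    earlier : ∀ i → 1 ≤ i → i < y → at q i ≢ k
    earlier i 1≤i i<y at-q-i≡k = <-irrefl (sym y≡i) i<y
      where
      i≤n : i ≤ n
      i≤n = ≤-trans (<⇒≤ i<y) y≤n
      y≡i : y ≡ i
      y≡i = trans (cong (at p) (trans (sym at-q-i≡k) (at-q i 1≤i i≤n)))
                  (at-indexOf p (∈-↭oneTo⁺ perm 1≤i i≤n))

-- Standardization and the order of positions

_≺[_]_ : ℕ → List ℕ → ℕ → Set
i ≺[ w ] j = at w i < at w j ⊎ (at w i ≡ at w j × i < j)

positionOrder : List ℕ → StrictTotalOrder 0ℓ 0ℓ 0ℓ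
positionOrder w = On.strictTotalOrder (×-strictTotalOrder <-strictTotalOrder <-strictTotalOrder) (λ i → at w i , i)

module _ (w : List ℕ) where

  open StrictTotalOrder (positionOrder w) using () renaming (irrefl to irrefl′; asym to asym′; trans to trans′)

  ≺-irrefl : ∀ {i} → ¬ i ≺[ w ] i
  ≺-irrefl = irrefl′ (refl , refl)

  ≺-asym : ∀ {i j} → i ≺[ w ] j → ¬ j ≺[ w ] i
  ≺-asym = asym′

  ≺-trans : ∀ {i j k} → i ≺[ w ] j → j ≺[ w ] k → i ≺[ w ] k
  ≺-trans = trans′

  private
    open import Relation.Binary.Properties.StrictTotalOrder (positionOrder w) using (decTotalOrder)
    open import Data.List.Sort decTotalOrder using (sort; sort-↭; sort-↗)

    strictify : ∀ {xs} → Linked (DecTotalOrder._≤_ decTotalOrder) xs → Unique xs → Linked (_≺[ w ]_) xs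
    strictify []                  _                  = []
    strictify [-]                 _                  = [-]
    strictify (inj₁ i≺j ∷ sorted) (_ ∷ u)            = i≺j ∷ strictify sorted u
    strictify (inj₂ (_ , i≡j) ∷ _) ((i≢j ∷ _) ∷ _) = ⊥-elim (i≢j i≡j)

  sortedPositions : List ℕ
  sortedPositions = sort (oneTo (length w))

  sortedPositions-↭ : sortedPositions ↭ oneTo (length w)
  sortedPositions-↭ = sort-↭ (oneTo (length w))

  sortedPositions-≺ : Linked (_≺[ w ]_) sortedPositions
  sortedPositions-≺ = strictify (sort-↗ (oneTo (length w))) (↭oneTo⇒unique sortedPositions-↭)

  _≺ᵇ_ : ℕ → ℕ → Bool
  j ≺ᵇ i = (at w j <ᵇ at w i) ∨ ((j <ᵇ i) ∧ (at w j ≡ᵇ at w i))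

  ≺⇒≺ᵇ≡true : ∀ {j i} → j ≺[ w ] i → (j ≺ᵇ i) ≡ true
  ≺⇒≺ᵇ≡true (inj₁ wj<wi) rewrite <⇒<ᵇ≡true wj<wi = refl
  ≺⇒≺ᵇ≡true (inj₂ (wj≡wi , j<i))
    rewrite ≮⇒<ᵇ≡false (<-irrefl wj≡wi) | <⇒<ᵇ≡true j<i | ≡⇒≡ᵇ≡true wj≡wi = refl

  ⊀⇒≺ᵇ≡false : ∀ {j i} → ¬ j ≺[ w ] i → (j ≺ᵇ i) ≡ false
  ⊀⇒≺ᵇ≡false {j} {i} j⊀i
    rewrite ≮⇒<ᵇ≡false (j⊀i ∘ inj₁) with j <? i
  ... | no j≮i rewrite ≮⇒<ᵇ≡false j≮i = refl
  ... | yes j<i rewrite <⇒<ᵇ≡true j<i = ≢⇒≡ᵇ≡false (λ wj≡wi → j⊀i (inj₂ (wj≡wi , j<i)))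

  std-≺ : std w ≡ map (λ i → suc (count (_≺ᵇ i) (oneTo (length w)))) (oneTo (length w))
  std-≺ = map-cong (λ i → cong suc (count-∨ _ _ (oneTo (length w)) (disjoint i))) (oneTo (length w))
    where
    disjoint : ∀ i j → ((at w j <ᵇ at w i) ∧ ((j <ᵇ i) ∧ (at w j ≡ᵇ at w i))) ≡ false
    disjoint i j with at w j <? at w i
    ... | no wj≮wi rewrite ≮⇒<ᵇ≡false wj≮wi = refl
    ... | yes wj<wi rewrite <⇒<ᵇ≡true wj<wi | ≢⇒≡ᵇ≡false (<⇒≢ wj<wi) = ∧-zeroʳ (j <ᵇ i)

  rank-sorted : ∀ pre {y} post → AllPairs (_≺[ w ]_) (pre ++ y ∷ post) →
                suc (count (_≺ᵇ y) (pre ++ y ∷ post)) ≡ indexOf y (pre ++ y ∷ post)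
  rank-sorted [] {y} post (y≺post ∷ _)
    rewrite ⊀⇒≺ᵇ≡false (≺-irrefl {y})
          | count-none (_≺ᵇ y) (All.map (⊀⇒≺ᵇ≡false ∘ ≺-asym) y≺post)
          | ≡⇒≡ᵇ≡true {y} refl = refl
  rank-sorted (x ∷ pre) {y} post (x≺rest ∷ sorted)
    with x≺y ← All.lookup x≺rest (∈-++⁺ʳ pre (here refl))
    rewrite ≺⇒≺ᵇ≡true x≺y
          | ≢⇒≡ᵇ≡false {x} {y} (λ { refl → ≺-irrefl x≺y })
          | sym (rank-sorted pre post sorted) = refl

  std≡invPerm : ∀ {p} → p ↭ oneTo (length w) → Linked (_≺[ w ]_) p → std w ≡ invPerm p
  std≡invPerm {p} perm sorted = begin
    std w
      ≡⟨ std-≺ ⟩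
    map (λ i → suc (count (_≺ᵇ i) (oneTo n))) (oneTo n)
      ≡⟨ map-cong-local (All.tabulate (rank ∘ ∈-resp-↭ (↭-sym perm))) ⟩
    map (λ i → indexOf i p) (oneTo n)
      ≡⟨ cong (λ m → map (λ i → indexOf i p) (oneTo m)) (sym ∣p∣≡n) ⟩
    invPerm p ∎
    where
    open ≡-Reasoning
    n = length w
    ∣p∣≡n : length p ≡ n
    ∣p∣≡n = length-↭oneTo perm
    rank : ∀ {y} → y ∈ p → suc (count (_≺ᵇ y) (oneTo n)) ≡ indexOf y p
    rank {y} y∈p with ∈-∃++ y∈p
    ... | pre , post , refl =
      trans (cong suc (count-↭ _ (↭-sym perm))) (rank-sorted pre post (Linked⇒AllPairs ≺-trans sorted))

  tau-unique : ∀ {p} → p ↭ oneTo (length w) → Linked (_≺[ w ]_) p → tau w ≡ p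
  tau-unique {p} perm sorted = begin
    invPerm (std w)     ≡⟨ cong invPerm (std≡invPerm perm sorted) ⟩
    invPerm (invPerm p) ≡⟨ invPerm-involutive (↭oneTo⇒IsPermutation perm) ⟩
    p                   ∎
    where open ≡-Reasoning

  tau≡sortedPositions : tau w ≡ sortedPositions
  tau≡sortedPositions = tau-unique sortedPositions-↭ sortedPositions-≺

  tau-↭ : tau w ↭ oneTo (length w)
  tau-↭ = subst (_↭ oneTo (length w)) (sym tau≡sortedPositions) sortedPositions-↭

  tau-≺ : Linked (_≺[ w ]_) (tau w)
  tau-≺ = subst (Linked (_≺[ w ]_)) (sym tau≡sortedPositions) sortedPositions-≺

-- Finitely supported sequences as blocks

fromBlocks : List (ℕ × ℕ) → List ℕ
fromBlocks []             = []
fromBlocks ((z , x) ∷ bs) = replicate z 0 ++ x ∷ fromBlocks bs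

letters : List (ℕ × ℕ) → List ℕ
letters = map proj₂

BlockForm : Seq → List (ℕ × ℕ) → Set
BlockForm a bs = All (_≢ 0) (letters bs) × (∀ i → a i ≡ at₀ (fromBlocks bs) i)

-- The nonzero entries of fromBlocks bs paired with their positions, counted from o.
locate : ℕ → List (ℕ × ℕ) → List (ℕ × ℕ)
locate o []             = []
locate o ((z , x) ∷ bs) = (o + z , x) ∷ locate (suc (o + z)) bs

shift : ℕ × ℕ → ℕ × ℕ
shift (j , x) = suc j , x

locate-suc : ∀ o bs → locate (suc o) bs ≡ map shift (locate o bs)
locate-suc o []             = refl
locate-suc o ((z , x) ∷ bs) = cong ((suc o + z , x) ∷_) (locate-suc (suc (o + z)) bs)

letters-locate : ∀ o bs → letters (locate o bs) ≡ letters bs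
letters-locate o []             = refl
letters-locate o ((z , x) ∷ bs) = cong (x ∷_) (letters-locate (suc (o + z)) bs)

length-locate : ∀ o bs → length (locate o bs) ≡ length (letters bs)
length-locate o []             = refl
length-locate o ((z , x) ∷ bs) = cong suc (length-locate (suc (o + z)) bs)

at₀-fromBlocks : ∀ z x bs → at₀ (fromBlocks ((z , x) ∷ bs)) z ≡ x
at₀-fromBlocks zero    x bs = refl
at₀-fromBlocks (suc z) x bs = at₀-fromBlocks z x bs

tailBlocks : List (ℕ × ℕ) → List (ℕ × ℕ)
tailBlocks []                   = []
tailBlocks ((zero  , x) ∷ bs)   = bs
tailBlocks ((suc z , x) ∷ bs)   = (z , x) ∷ bs

BlockForm-tail : ∀ {a} bs → BlockForm a bs → BlockForm (a ∘ suc) (tailBlocks bs)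
BlockForm-tail []                 (_             , a≗) = [] , a≗ ∘ suc
BlockForm-tail ((zero  , x) ∷ bs) (_ ∷ bs≢0      , a≗) = bs≢0 , a≗ ∘ suc
BlockForm-tail ((suc z , x) ∷ bs) (x≢0 ∷ bs≢0    , a≗) = x≢0 ∷ bs≢0 , a≗ ∘ suc

blockForm : ∀ N a → BoundedBy N a → Σ (List (ℕ × ℕ)) (BlockForm a)
blockForm zero    a bounded = [] , [] , λ i → bounded i z≤n
blockForm (suc N) a bounded with blockForm N (a ∘ suc) (λ i N≤i → bounded (suc i) (s≤s N≤i)) | a 0 ≟ 0
... | bs , bs≢0 , a≗ | no a₀≢0 =
  (0 , a 0) ∷ bs , a₀≢0 ∷ bs≢0 , λ { zero → refl ; (suc i) → a≗ i }
... | [] , _ , a≗ | yes a₀≡0 =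
  [] , [] , λ { zero → a₀≡0 ; (suc i) → a≗ i }
... | (z , x) ∷ bs , bs≢0 , a≗ | yes a₀≡0 =
  (suc z , x) ∷ bs , bs≢0 , λ { zero → a₀≡0 ; (suc i) → a≗ i }

consNonzero : ℕ → List (ℕ × ℕ) → List (ℕ × ℕ)
consNonzero x r = if x ≡ᵇ 0 then r else (1 , x) ∷ r

-- Defs.nonzeros shifts positions with a pattern lambda, only pointwise equal to shift.
nonzeros-suc : ∀ N a → nonzeros (suc N) a ≡ consNonzero (a 0) (map shift (nonzeros N (a ∘ suc)))
nonzeros-suc N a = cong (consNonzero (a 0)) (map-cong (λ { (j , x) → refl }) (nonzeros N (a ∘ suc)))

consNonzero-locate : ∀ {a} bs → BlockForm a bs → consNonzero (a 0) (locate 2 (tailBlocks bs)) ≡ locate 1 bs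
consNonzero-locate []                 (_ , a≗)         rewrite a≗ 0 = refl
consNonzero-locate ((zero  , x) ∷ bs) (x≢0 ∷ _ , a≗)   rewrite a≗ 0 | ≢⇒≡ᵇ≡false x≢0 = refl
consNonzero-locate ((suc z , x) ∷ bs) (_ , a≗)         rewrite a≗ 0 = refl

nonzeros-blocks : ∀ N {a} bs → BoundedBy N a → BlockForm a bs → nonzeros N a ≡ locate 1 bs
nonzeros-blocks zero    []             _       _ = refl
nonzeros-blocks zero    ((z , x) ∷ bs) bounded (x≢0 ∷ _ , a≗) =
  ⊥-elim (x≢0 (trans (sym (at₀-fromBlocks z x bs)) (trans (sym (a≗ z)) (bounded z z≤n))))
nonzeros-blocks (suc N) {a} bs bounded form = begin
  nonzeros (suc N) a
    ≡⟨ nonzeros-suc N a ⟩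
  consNonzero (a 0) (map shift (nonzeros N (a ∘ suc)))
    ≡⟨ cong (consNonzero (a 0) ∘ map shift) tail≡ ⟩
  consNonzero (a 0) (map shift (locate 1 (tailBlocks bs)))
    ≡⟨ cong (consNonzero (a 0)) (sym (locate-suc 1 (tailBlocks bs))) ⟩
  consNonzero (a 0) (locate 2 (tailBlocks bs))
    ≡⟨ consNonzero-locate bs form ⟩
  locate 1 bs ∎
  where
  open ≡-Reasoning
  tail≡ : nonzeros N (a ∘ suc) ≡ locate 1 (tailBlocks bs)
  tail≡ = nonzeros-blocks N (tailBlocks bs) (λ i N≤i → bounded (suc i) (s≤s N≤i)) (BlockForm-tail bs form)

-- Tables of entries (letter, value)

keys : List (ℕ × ℕ) → List ℕ
keys = map proj₁

graph : (ℕ → ℕ) → List ℕ → List (ℕ × ℕ)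
graph h = map (λ t → t , h t)

keys-graph : ∀ h p → keys (graph h p) ≡ p
keys-graph h p = trans (sym (map-∘ p)) (map-id p)

tableWord : ℕ → List (ℕ × ℕ) → List ℕ
tableWord n es = map (λ k → assoc k es) (oneTo n)

assoc-graph : ∀ (h : ℕ → ℕ) {k} p → k ∈ p → assoc k (graph h p) ≡ h k
assoc-graph h {k} (x ∷ p) k∈ with x ≟ k
... | yes refl rewrite ≡⇒≡ᵇ≡true {x} refl = refl
... | no x≢k rewrite ≢⇒≡ᵇ≡false x≢k with k∈
...   | here k≡x   = ⊥-elim (x≢k (sym k≡x))
...   | there k∈p = assoc-graph h p k∈p

assoc-∈ : ∀ {k} es → k ∈ keys es → (k , assoc k es) ∈ es
assoc-∈ {k} ((x , v) ∷ es) k∈ with x ≟ k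
... | yes refl rewrite ≡⇒≡ᵇ≡true {x} refl = here refl
... | no x≢k rewrite ≢⇒≡ᵇ≡false x≢k with k∈
...   | here k≡x   = ⊥-elim (x≢k (sym k≡x))
...   | there k∈es = there (assoc-∈ es k∈es)

graph-assoc : ∀ es → Unique (keys es) → es ≡ graph (λ k → assoc k es) (keys es)
graph-assoc []             _           = refl
graph-assoc ((x , v) ∷ es) (x∉ ∷ unique) rewrite ≡⇒≡ᵇ≡true {x} refl =
  cong ((x , v) ∷_) (trans (graph-assoc es unique) (map-cong-local (All.map later x∉)))
  where
  later : ∀ {k} → x ≢ k → (k , assoc k es) ≡ (k , assoc k ((x , v) ∷ es))
  later x≢k rewrite ≢⇒≡ᵇ≡false x≢k = refl

tableWord-graph : ∀ (h : ℕ → ℕ) {p n} → p ↭ oneTo n → tableWord n (graph h p) ≡ map h (oneTo n)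
tableWord-graph h perm = map-cong-local (All.tabulate (assoc-graph h _ ∘ ∈-resp-↭ (↭-sym perm)))

-- Decoding blocks into tables and encoding them back

-- The recurrence of g: z zeros separate the consecutive letters p and x.
nextValue : ℕ → ℕ → ℕ → ℕ → ℕ
nextValue p v z x = if p <ᵇ x then v + z else suc (v + z)

decodeFrom : ℕ → ℕ → List (ℕ × ℕ) → List (ℕ × ℕ)
decodeFrom p v []             = []
decodeFrom p v ((z , x) ∷ bs) = (x , nextValue p v z x) ∷ decodeFrom x (nextValue p v z x) bs

decode : List (ℕ × ℕ) → List (ℕ × ℕ)
decode []             = []
decode ((z , x) ∷ bs) = (x , suc z) ∷ decodeFrom x (suc z) bs

-- The number of zeros f puts between the consecutive entries (p , v) and (x , v′).
gap : ℕ → ℕ → ℕ → ℕ → ℕ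
gap p v x v′ = if x <ᵇ p then v′ ∸ v ∸ 1 else v′ ∸ v

encodeFrom : ℕ → ℕ → List (ℕ × ℕ) → List (ℕ × ℕ)
encodeFrom p v []              = []
encodeFrom p v ((x , v′) ∷ es) = (gap p v x v′ , x) ∷ encodeFrom x v′ es

encode : List (ℕ × ℕ) → List (ℕ × ℕ)
encode []             = []
encode ((x , v) ∷ es) = (v ∸ 1 , x) ∷ encodeFrom x v es

-- How consecutive entries (τᵢ , w τᵢ) and (τᵢ₊₁ , w τᵢ₊₁) of a word read along τ are related.
_↝_ : ℕ × ℕ → ℕ × ℕ → Set
(p , v) ↝ (x , v′) = (x < p × v < v′) ⊎ (p < x × v ≤ v′)

decodeFrom-↝ : ∀ p v bs → Linked _≢_ (p ∷ letters bs) → Linked _↝_ ((p , v) ∷ decodeFrom p v bs)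
decodeFrom-↝ p v []             _               = [-]
decodeFrom-↝ p v ((z , x) ∷ bs) (p≢x ∷ distinct) = step ∷ decodeFrom-↝ x (nextValue p v z x) bs distinct
  where
  step : (p , v) ↝ (x , nextValue p v z x)
  step with <-cmp p x
  ... | tri< p<x _ _ rewrite <⇒<ᵇ≡true p<x = inj₂ (p<x , m≤m+n v z)
  ... | tri≈ _ p≡x _ = ⊥-elim (p≢x p≡x)
  ... | tri> _ _ x<p rewrite ≮⇒<ᵇ≡false (<-asym x<p) = inj₁ (x<p , s≤s (m≤m+n v z))

decode-↝ : ∀ bs → Linked _≢_ (letters bs) → Linked _↝_ (decode bs)
decode-↝ []             _        = []
decode-↝ ((z , x) ∷ bs) distinct = decodeFrom-↝ x (suc z) bs distinct

v≤nextValue : ∀ p v z x → v ≤ nextValue p v z x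
v≤nextValue p v z x with p <ᵇ x
... | true  = m≤m+n v z
... | false = m≤n⇒m≤1+n (m≤m+n v z)

decodeFrom-≥ : ∀ p v bs → All ((v ≤_) ∘ proj₂) (decodeFrom p v bs)
decodeFrom-≥ p v []             = []
decodeFrom-≥ p v ((z , x) ∷ bs) =
  v≤v′ ∷ All.map (≤-trans v≤v′) (decodeFrom-≥ x (nextValue p v z x) bs)
  where
  v≤v′ : v ≤ nextValue p v z x
  v≤v′ = v≤nextValue p v z x

decode-positive : ∀ bs → All ((1 ≤_) ∘ proj₂) (decode bs)
decode-positive []             = []
decode-positive ((z , x) ∷ bs) = s≤s z≤n ∷ All.map (≤-trans (s≤s z≤n)) (decodeFrom-≥ x (suc z) bs)

gap-nextValue : ∀ {p x} v z → p ≢ x → gap p v x (nextValue p v z x) ≡ z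
gap-nextValue {p} {x} v z p≢x with <-cmp p x
... | tri< p<x _ _ rewrite <⇒<ᵇ≡true p<x | ≮⇒<ᵇ≡false (<-asym p<x) = m+n∸m≡n v z
... | tri≈ _ p≡x _ = ⊥-elim (p≢x p≡x)
... | tri> _ _ x<p rewrite <⇒<ᵇ≡true x<p | ≮⇒<ᵇ≡false (<-asym x<p) | sym (+-suc v z) =
  cong (_∸ 1) (m+n∸m≡n v (suc z))

nextValue-gap : ∀ {p v x v′} → (p , v) ↝ (x , v′) → nextValue p v (gap p v x v′) x ≡ v′
nextValue-gap {v = v} {v′ = v′} (inj₁ (x<p , v<v′))
  rewrite <⇒<ᵇ≡true x<p | ≮⇒<ᵇ≡false (<-asym x<p) | ∸-+-assoc v′ v 1 | +-comm v 1 =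
  m+[n∸m]≡n v<v′
nextValue-gap (inj₂ (p<x , v≤v′))
  rewrite ≮⇒<ᵇ≡false (<-asym p<x) | <⇒<ᵇ≡true p<x = m+[n∸m]≡n v≤v′

encodeFrom-decodeFrom : ∀ p v bs → Linked _≢_ (p ∷ letters bs) → encodeFrom p v (decodeFrom p v bs) ≡ bs
encodeFrom-decodeFrom p v []             _                 = refl
encodeFrom-decodeFrom p v ((z , x) ∷ bs) (p≢x ∷ distinct)
  rewrite gap-nextValue v z p≢x = cong ((z , x) ∷_) (encodeFrom-decodeFrom x (nextValue p v z x) bs distinct)

encode-decode : ∀ bs → Linked _≢_ (letters bs) → encode (decode bs) ≡ bs
encode-decode []             _        = refl
encode-decode ((z , x) ∷ bs) distinct = cong ((z , x) ∷_) (encodeFrom-decodeFrom x (suc z) bs distinct)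

decodeFrom-encodeFrom : ∀ p v es → Linked _↝_ ((p , v) ∷ es) → decodeFrom p v (encodeFrom p v es) ≡ es
decodeFrom-encodeFrom p v []               _                  = refl
decodeFrom-encodeFrom p v ((x , v′) ∷ es) (step ∷ admissible)
  rewrite nextValue-gap step = cong ((x , v′) ∷_) (decodeFrom-encodeFrom x v′ es admissible)

decode-encode : ∀ es → Linked _↝_ es → All ((1 ≤_) ∘ proj₂) es → decode (encode es) ≡ es
decode-encode []                 _          _       = refl
decode-encode ((x , zero) ∷ es)  _          (() ∷ _)
decode-encode ((x , suc v) ∷ es) admissible (_ ∷ _) =
  cong ((x , suc v) ∷_) (decodeFrom-encodeFrom x (suc v) es admissible)

keys-decode : ∀ bs → keys (decode bs) ≡ letters bs
keys-decode []             = refl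
keys-decode ((z , x) ∷ bs) = cong (x ∷_) (keysFrom x (suc z) bs)
  where
  keysFrom : ∀ p v bs → keys (decodeFrom p v bs) ≡ letters bs
  keysFrom p v []             = refl
  keysFrom p v ((z , x) ∷ bs) = cong (x ∷_) (keysFrom x _ bs)

letters-encode : ∀ es → letters (encode es) ≡ keys es
letters-encode []             = refl
letters-encode ((x , v) ∷ es) = cong (x ∷_) (lettersFrom x v es)
  where
  lettersFrom : ∀ p v es → letters (encodeFrom p v es) ≡ keys es
  lettersFrom p v []              = refl
  lettersFrom p v ((x , v′) ∷ es) = cong (x ∷_) (lettersFrom x v′ es)

-- g and f through blocks

gGo-locate : ∀ j p v bs → gGo j p v (locate (suc j) bs) ≡ decodeFrom p v bs
gGo-locate j p v []             = refl
gGo-locate j p v ((z , x) ∷ bs) =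
  cong₂ (λ v′ r → (x , v′) ∷ r) value
        (trans (cong (λ v′ → gGo (suc j + z) x v′ _) value) (gGo-locate (suc j + z) x _ bs))
  where
  value : (if p <ᵇ x then v + (suc j + z ∸ j) ∸ 1 else v + (suc j + z ∸ j)) ≡ nextValue p v z x
  value rewrite +-∸-assoc 1 (m≤m+n j z) | m+n∸m≡n j z | +-suc v z with p <ᵇ x
  ... | true  = refl
  ... | false = refl

gVals-locate : ∀ bs → gVals (locate 1 bs) ≡ decode bs
gVals-locate []             = refl
gVals-locate ((z , x) ∷ bs) = cong ((x , suc z) ∷_) (gGo-locate (suc z) x (suc z) bs)

g-blocks : ∀ N {a} bs → BoundedBy N a → BlockForm a bs → g N a ≡ tableWord (length (letters bs)) (decode bs)
g-blocks N bs bounded form rewrite nonzeros-blocks N bs bounded form =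
  cong₂ tableWord (length-locate 1 bs) (gVals-locate bs)

assocPerm-blocks : ∀ N {a} bs → BoundedBy N a → BlockForm a bs → assocPerm N a ≡ letters bs
assocPerm-blocks N bs bounded form rewrite nonzeros-blocks N bs bounded form = letters-locate 1 bs

fList-encode : ∀ w → fList w ≡ fromBlocks (encode (graph (at w) (tau w)))
fList-encode w with tau w
... | []     = refl
... | t ∷ ts = cong (λ r → replicate (at w t ∸ 1) 0 ++ t ∷ r) (steps t ts)
  where
  steps : ∀ t ts → fSteps w t ts ≡ fromBlocks (encodeFrom t (at w t) (graph (at w) ts))
  steps t []        = refl
  steps t (t′ ∷ ts) = cong (λ r → replicate (gap t (at w t) t′ (at w t′)) 0 ++ t′ ∷ r) (steps t′ ts)

≺⇒↝ : ∀ w {t t′} → t ≺[ w ] t′ → (t , at w t) ↝ (t′ , at w t′)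
≺⇒↝ w {t} {t′} (inj₂ (wt≡wt′ , t<t′)) = inj₂ (t<t′ , ≤-reflexive wt≡wt′)
≺⇒↝ w {t} {t′} (inj₁ wt<wt′) with <-cmp t t′
... | tri< t<t′ _ _ = inj₂ (t<t′ , <⇒≤ wt<wt′)
... | tri≈ _ refl _ = ⊥-elim (<-irrefl refl wt<wt′)
... | tri> _ _ t′<t = inj₁ (t′<t , wt<wt′)

↝⇒≺ : ∀ w {t t′} → (t , at w t) ↝ (t′ , at w t′) → t ≺[ w ] t′
↝⇒≺ w (inj₁ (_ , wt<wt′)) = inj₁ wt<wt′
↝⇒≺ w (inj₂ (t<t′ , wt≤wt′)) with m≤n⇒m<n∨m≡n wt≤wt′
... | inj₁ wt<wt′ = inj₁ wt<wt′
... | inj₂ wt≡wt′ = inj₂ (wt≡wt′ , t<t′)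

wordBlocks : List ℕ → List (ℕ × ℕ)
wordBlocks w = encode (graph (at w) (tau w))

f-wordBlocks : ∀ w i → f w i ≡ at₀ (fromBlocks (wordBlocks w)) i
f-wordBlocks w i = cong (λ l → at₀ l i) (fList-encode w)

letters-wordBlocks : ∀ w → letters (wordBlocks w) ≡ tau w
letters-wordBlocks w = trans (letters-encode (graph (at w) (tau w))) (keys-graph (at w) (tau w))

module _ (w : List ℕ) where

  wordBlocks-form : BlockForm (f w) (wordBlocks w)
  wordBlocks-form = subst (All (_≢ 0)) (sym (letters-wordBlocks w)) (All.tabulate tau-nonzero) , f-wordBlocks w
    where
    tau-nonzero : ∀ {t} → t ∈ tau w → t ≢ 0
    tau-nonzero t∈ t≡0 = <-irrefl (sym t≡0) (proj₁ (∈-↭oneTo⁻ (tau-↭ w) t∈))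

  f∈E : InE (f w)
  f∈E = length (fList w) , bounded , subst IsPermutation (sym assocPerm≡tau) (↭oneTo⇒IsPermutation (tau-↭ w))
    where
    bounded : BoundedBy (length (fList w)) (f w)
    bounded = at₀-beyond (fList w)
    assocPerm≡tau : assocPerm (length (fList w)) (f w) ≡ tau w
    assocPerm≡tau = trans (assocPerm-blocks _ (wordBlocks w) bounded wordBlocks-form) (letters-wordBlocks w)

  decode-wordBlocks : All (1 ≤_) w → decode (wordBlocks w) ≡ graph (at w) (tau w)
  decode-wordBlocks positive =
    decode-encode _ (map⁺ (Linked.map (≺⇒↝ w) (tau-≺ w))) (All.map⁺ (All.tabulate positive-entry))
    where
    positive-entry : ∀ {t} → t ∈ tau w → 1 ≤ at w t
    positive-entry t∈ = All.lookup positive (uncurry (at-∈ w _) (∈-↭oneTo⁻ (tau-↭ w) t∈))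

  g∘f : All (1 ≤_) w → ∀ N → BoundedBy N (f w) → g N (f w) ≡ w
  g∘f positive N bounded = begin
    g N (f w)
      ≡⟨ g-blocks N (wordBlocks w) bounded wordBlocks-form ⟩
    tableWord (length (letters (wordBlocks w))) (decode (wordBlocks w))
      ≡⟨ cong₂ tableWord ∣bs∣≡n (decode-wordBlocks positive) ⟩
    tableWord n (graph (at w) (tau w))
      ≡⟨ tableWord-graph (at w) (tau-↭ w) ⟩
    map (at w) (oneTo n)
      ≡⟨ map-at-oneTo w ⟩
    w ∎
    where
    open ≡-Reasoning
    n = length w
    ∣bs∣≡n : length (letters (wordBlocks w)) ≡ n
    ∣bs∣≡n = trans (cong length (letters-wordBlocks w)) (length-↭oneTo (tau-↭ w))

module _ (bs : List (ℕ × ℕ)) (perm : IsPermutation (letters bs)) where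

  private
    n = length (letters bs)
    distinct : Linked _≢_ (letters bs)
    distinct = AllPairs⇒Linked (↭oneTo⇒unique perm)

  decodedWord : List ℕ
  decodedWord = tableWord n (decode bs)

  decode≡graph : decode bs ≡ graph (at decodedWord) (letters bs)
  decode≡graph = begin
    decode bs                                            ≡⟨ graph-assoc (decode bs) unique-keys ⟩
    graph (λ k → assoc k (decode bs)) (keys (decode bs)) ≡⟨ cong (graph _) (keys-decode bs) ⟩
    graph (λ k → assoc k (decode bs)) (letters bs)       ≡⟨ map-cong-local (All.tabulate lookup-decodedWord) ⟩
    graph (at decodedWord) (letters bs)                  ∎
    where
    open ≡-Reasoning
    unique-keys : Unique (keys (decode bs))
    unique-keys = subst Unique (sym (keys-decode bs)) (↭oneTo⇒unique perm)
    lookup-decodedWord : ∀ {k} → k ∈ letters bs → (k , assoc k (decode bs)) ≡ (k , at decodedWord k)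
    lookup-decodedWord {k} k∈ =
      cong (k ,_) (sym (uncurry (at-map-oneTo (λ k → assoc k (decode bs)) n k) (∈-↭oneTo⁻ perm k∈)))

  tau-decodedWord : tau decodedWord ≡ letters bs
  tau-decodedWord = tau-unique decodedWord (subst (λ m → letters bs ↭ oneTo m) (sym ∣w∣≡n) perm) sorted
    where
    ∣w∣≡n : length decodedWord ≡ n
    ∣w∣≡n = trans (length-map _ (oneTo n)) (length-oneTo n)
    sorted : Linked (_≺[ decodedWord ]_) (letters bs)
    sorted = Linked.map (↝⇒≺ decodedWord) (map⁻ (subst (Linked _↝_) decode≡graph (decode-↝ bs distinct)))

  wordBlocks-decodedWord : wordBlocks decodedWord ≡ bs
  wordBlocks-decodedWord = begin
    encode (graph (at decodedWord) (tau decodedWord))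
      ≡⟨ cong (encode ∘ graph (at decodedWord)) tau-decodedWord ⟩
    encode (graph (at decodedWord) (letters bs))
      ≡⟨ cong encode (sym decode≡graph) ⟩
    encode (decode bs)
      ≡⟨ encode-decode bs distinct ⟩
    bs ∎
    where open ≡-Reasoning

  decodedWord-positive : All (1 ≤_) decodedWord
  decodedWord-positive =
    All.map⁺ (All.tabulate (All.lookup (decode-positive bs) ∘ assoc-∈ (decode bs) ∘ k∈keys))
    where
    k∈keys : ∀ {k} → k ∈ oneTo n → k ∈ keys (decode bs)
    k∈keys {k} k∈ = subst (k ∈_) (sym (keys-decode bs)) (∈-resp-↭ (↭-sym perm) k∈)

f∘g : ∀ a N → BoundedBy N a → IsPermutation (assocPerm N a) →
      All (1 ≤_) (g N a) × (∀ i → f (g N a) i ≡ a i)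
f∘g a N bounded perm with blockForm N a bounded
... | bs , form rewrite g-blocks N bs bounded form = decodedWord-positive bs perm′ , f-decodedWord
  where
  perm′ : IsPermutation (letters bs)
  perm′ = subst IsPermutation (assocPerm-blocks N bs bounded form) perm
  f-decodedWord : ∀ i → f (decodedWord bs perm′) i ≡ a i
  f-decodedWord i = begin
    f (decodedWord bs perm′) i
      ≡⟨ f-wordBlocks (decodedWord bs perm′) i ⟩
    at₀ (fromBlocks (wordBlocks (decodedWord bs perm′))) i
      ≡⟨ cong (λ bs′ → at₀ (fromBlocks bs′) i) (wordBlocks-decodedWord bs perm′) ⟩
    at₀ (fromBlocks bs) i
      ≡⟨ sym (proj₂ form i) ⟩
    a i ∎
    where open ≡-Reasoning

mainTheorem6 : ((w : List ℕ) → All (1 ≤_) w →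
    InE (f w) × ((N : ℕ) → BoundedBy N (f w) → g N (f w) ≡ w))
    × ((a : Seq) (N : ℕ) → BoundedBy N a → IsPermutation (assocPerm N a) →
    All (1 ≤_) (g N a) × ((i : ℕ) → f (g N a) i ≡ a i))
mainTheorem6 = (λ w positive → f∈E w , g∘f w positive) , f∘g
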